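{- Let $m, n \in \mathbb{N}$ and let $A, B \subseteq \mathbb{Z}^m \times \mathbb{Z}^{n+1}$ be weak cells (in $\mathbb{Z}^{m+n+1}$). Then $A \diamond B$ is a weak cell in $\mathbb{Z}^{2m+n+1}$.
   Context: A set or function is Presburger if it (respectively its graph) is first-order definable in $(\mathbb{Z},<,+)$. A weak cell in $\mathbb{Z}^{d+1}$ is a set of one of the following forms: (i) $S \times \{t \in \mathbb{Z} : t \equiv k \pmod N\}$; (ii) $\{(x,t) \in \mathbb{Z}^{d+1} : x \in S,\ f(x) \le t,\ t \equiv k \pmod N\}$; (iii) $\{(x,t) \in \mathbb{Z}^{d+1} : x \in S,\ t \le g(x),\ t \equiv k \pmod N\}$; (iv) $\{(x,t) \in \mathbb{Z}^{d+1} : x \in S,\ f(x) \le t \le g(x),\ t \equiv k \pmod N\}$, where $S \subseteq \mathbb{Z}^d$ and $f, g : \mathbb{Z}^d \to \mathbb{Z}$ are Presburger and $k, N \in \mathbb{Z}$. For $A \subseteq \mathbb{Z}^l \times \mathbb{Z}^p$ and $B \subseteq \mathbb{Z}^{m} \times \mathbb{Z}^p$, the diamond product is $A \diamond B = \{(x,y,z) \in \mathbb{Z}^{l+m+p} : (x,z) \in A \wedge (y,z) \in B\}$ (here with $l = m$ and $p = n+1$). -}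

module Defs where

open import Data.Nat using (ℕ; suc; _+_)
open import Data.Fin using (Fin)
open import Data.Integer using (ℤ; _-_; _<_)
open import Data.Integer.Divisibility using (_∣_)
open import Data.Vec using (Vec; _∷_; _++_; lookup; head; tail; take; drop)
open import Data.Product using (Σ; _×_; _,_)
open import Data.Sum using (_⊎_)
open import Relation.Nullary using (¬_)
open import Relation.Binary.PropositionalEquality using (_≡_)
open import Function.Bundles using (_⇔_)

-- First-order logic over the signature (<, +) with equality,
-- interpreted in the structure (ℤ, <, +).
-- Formulas with k free variables (de Bruijn style, Fin k).

data Term (k : ℕ) : Set where
  var  : Fin k → Term k
  _⊕_  : Term k → Term k → Term k

data Form (k : ℕ) : Set where
  _≐_  : Term k → Term k → Form k
  _≺_  : Term k → Term k → Form k
  ¬'_  : Form k → Form k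
  _∧'_ : Form k → Form k → Form k
  _∨'_ : Form k → Form k → Form k
  _⇒'_ : Form k → Form k → Form k
  ∃'_  : Form (suc k) → Form k
  ∀'_  : Form (suc k) → Form k

evalT : ∀ {k} → Term k → Vec ℤ k → ℤ
evalT (var i) ρ = lookup ρ i
evalT (s ⊕ t) ρ = evalT s ρ Data.Integer.+ evalT t ρ

⟦_⟧ : ∀ {k} → Form k → Vec ℤ k → Set
⟦ s ≐ t ⟧ ρ = evalT s ρ ≡ evalT t ρ
⟦ s ≺ t ⟧ ρ = evalT s ρ < evalT t ρ
⟦ ¬' φ ⟧ ρ = ¬ ⟦ φ ⟧ ρ
⟦ φ ∧' ψ ⟧ ρ = ⟦ φ ⟧ ρ × ⟦ ψ ⟧ ρ
⟦ φ ∨' ψ ⟧ ρ = ⟦ φ ⟧ ρ ⊎ ⟦ ψ ⟧ ρ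
⟦ φ ⇒' ψ ⟧ ρ = ⟦ φ ⟧ ρ → ⟦ ψ ⟧ ρ
⟦ ∃' φ ⟧ ρ = Σ ℤ λ a → ⟦ φ ⟧ (a ∷ ρ)
⟦ ∀' φ ⟧ ρ = (a : ℤ) → ⟦ φ ⟧ (a ∷ ρ)

Presburger : ∀ {d} → (Vec ℤ d → Set) → Set
Presburger {d} S = Σ (Form d) λ φ → (x : Vec ℤ d) → S x ⇔ ⟦ φ ⟧ x

-- A function f : ℤ^d → ℤ is Presburger if its graph is
-- (graph encoded as { (t ∷ x) : f x ≡ t } ⊆ ℤ^(1+d)).
PresburgerFn : ∀ {d} → (Vec ℤ d → ℤ) → Set
PresburgerFn f = Presburger (λ v → f (tail v) ≡ head v)

_≡_[mod_] : ℤ → ℤ → ℤ → Set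
t ≡ k [mod N ] = N ∣ (t - k)

-- Weak cells.  A subset of ℤ^(d+1) is represented as a predicate on
-- ℤ^d × ℤ (points (x , t)).  Set equality is pointwise ⇔.

WeakCell : (d : ℕ) → (Vec ℤ d × ℤ → Set) → Set₁
WeakCell d C =
  Σ (Vec ℤ d → Set) λ S → Presburger S × Σ ℤ λ k → Σ ℤ λ N →
    ((∀ x t → C (x , t) ⇔ (S x × t ≡ k [mod N ])))
    ⊎
    (Σ (Vec ℤ d → ℤ) λ f → PresburgerFn f ×
      (∀ x t → C (x , t) ⇔ (S x × f x Data.Integer.≤ t × t ≡ k [mod N ])))
    ⊎
    (Σ (Vec ℤ d → ℤ) λ g → PresburgerFn g ×
      (∀ x t → C (x , t) ⇔ (S x × t Data.Integer.≤ g x × t ≡ k [mod N ])))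
    ⊎
    (Σ (Vec ℤ d → ℤ) λ f → Σ (Vec ℤ d → ℤ) λ g → PresburgerFn f × PresburgerFn g ×
      (∀ x t → C (x , t) ⇔
         (S x × f x Data.Integer.≤ t × t Data.Integer.≤ g x × t ≡ k [mod N ])))

-- Diamond product with l = m, p = n + 1.
-- A, B ⊆ ℤ^m × ℤ^(n+1), a point written (x ++ z' , t) with x ∈ ℤ^m,
-- z = (z' , t) ∈ ℤ^(n+1).  A ⋄ B ⊆ ℤ^(m+m+n+1), points (x ++ y ++ z' , t).

Diamond : (m n : ℕ) → (Vec ℤ (m + n) × ℤ → Set) → (Vec ℤ (m + n) × ℤ → Set)
        → Vec ℤ (m + (m + n)) × ℤ → Set
Diamond m n A B (v , t) =
  A (take m v ++ drop m (drop m v) , t) × B (take m (drop m v) ++ drop m (drop m v) , t)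

{-# OPTIONS --safe #-}

-- Every weak cell has the uniform shape  S x ∧ lo x ≤ t ≤ hi x ∧ t ≡ k (mod N)  with both bounds
-- optional.  The two factors of A ⋄ B are such cells pulled back along coordinate projections, and
-- pulling back preserves Presburger definability (rename the variables of the defining formula).
-- Their intersection again has this shape: intersect the bases, take the maximum of the lower and
-- the minimum of the upper bounds (both Presburger), and intersect the congruences.  Two residue
-- classes meet either nowhere, and then the cell is empty, or in one class modulo lcm(N₁, N₂); which
-- case occurs is decided by searching a common period for a solution.

module Submission where

open import Defs
open import Data.Nat using (ℕ; _+_)
import Data.Nat as ℕ
import Data.Nat.Properties as ℕ
import Data.Nat.Divisibility as ℕ
open import Data.Nat.LCM using (lcm; lcm-least; m∣lcm[m,n]; n∣lcm[m,n])
open import Data.Integer using (ℤ)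
import Data.Integer as ℤ
import Data.Integer.Properties as ℤ
open import Data.Integer.Divisibility using (_∣_)
import Data.Integer.Divisibility.Signed as Signed
open import Data.Integer.DivMod using (_/ℕ_; _%ℕ_; n%ℕd<d; a≡a%ℕn+[a/ℕn]*n)
open import Data.Integer.Tactic.RingSolver using (solve-∀)
open import Data.Fin using (Fin; zero; suc; _↑ˡ_; _↑ʳ_; splitAt; toℕ; fromℕ<)
import Data.Fin.Properties as Fin
open import Data.Vec using (Vec; _∷_; []; _++_; lookup; head; tail; take; drop)
import Data.Vec.Properties as Vec
open import Data.Product using (Σ; _×_; _,_; proj₁; proj₂; uncurry)
open import Data.Product.Function.NonDependent.Propositional using (_×-⇔_)
import Data.Product.Function.Dependent.Propositional as Σ
open import Data.Sum using (_⊎_; inj₁; inj₂; [_,_]′)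
open import Data.Sum.Function.Propositional using (_⊎-⇔_)
open import Data.Empty using (⊥; ⊥-elim)
open import Data.Unit using (⊤)
open import Data.Maybe using (Maybe; just; nothing)
import Data.Maybe as Maybe
open import Function using (_∘_)
open import Function.Bundles using (_⇔_; mk⇔; Equivalence)
open import Function.Construct.Identity using (⇔-id)
open import Function.Construct.Symmetry using (⇔-sym)
open import Function.Construct.Composition using (_⇔-∘_)
open import Function.Related.TypeIsomorphisms using (¬-cong-⇔; →-cong-⇔)
open import Relation.Nullary using (¬_; Dec; yes; no)
open import Relation.Nullary.Decidable using (_×-dec_)
open import Relation.Binary.PropositionalEquality
  using (_≡_; refl; sym; trans; cong; cong₂; subst; module ≡-Reasoning)

open Equivalence

-- A record rather than a function type, so that ρ, w and v can be inferred from a proof.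
record Selects {k k'} (ρ : Fin k → Fin k') (w : Vec ℤ k') (v : Vec ℤ k) : Set where
  constructor selecting
  field lookup-selected : ∀ i → lookup w (ρ i) ≡ lookup v i
open Selects

lift : ∀ {k k'} → (Fin k → Fin k') → Fin (ℕ.suc k) → Fin (ℕ.suc k')
lift ρ zero    = zero
lift ρ (suc i) = suc (ρ i)

Selects-∷ : ∀ {k k'} {ρ : Fin k → Fin k'} {w v} a → Selects ρ w v → Selects (lift ρ) (a ∷ w) (a ∷ v)
Selects-∷ a sel = selecting λ { zero → refl ; (suc i) → lookup-selected sel i }

take-selects : ∀ m {k} (v : Vec ℤ (m + k)) → Selects (_↑ˡ k) v (take m v)
take-selects m {k} v = selecting λ i → begin
  lookup v (i ↑ˡ k)                       ≡⟨ cong (λ u → lookup u (i ↑ˡ k)) (Vec.take++drop≡id m v) ⟨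
  lookup (take m v ++ drop m v) (i ↑ˡ k)  ≡⟨ Vec.lookup-++ˡ (take m v) (drop m v) i ⟩
  lookup (take m v) i                     ∎
  where open ≡-Reasoning

drop-selects : ∀ m {k} (v : Vec ℤ (m + k)) → Selects (m ↑ʳ_) v (drop m v)
drop-selects m v = selecting λ i → begin
  lookup v (m ↑ʳ i)                       ≡⟨ cong (λ u → lookup u (m ↑ʳ i)) (Vec.take++drop≡id m v) ⟨
  lookup (take m v ++ drop m v) (m ↑ʳ i)  ≡⟨ Vec.lookup-++ʳ (take m v) (drop m v) i ⟩
  lookup (drop m v) i                     ∎
  where open ≡-Reasoning

Selects-∘ : ∀ {j k l} {ρ : Fin k → Fin l} {σ : Fin j → Fin k} {u v w} →
            Selects ρ u v → Selects σ v w → Selects (ρ ∘ σ) u w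
Selects-∘ {σ = σ} ρ-sel σ-sel =
  selecting λ i → trans (lookup-selected ρ-sel (σ i)) (lookup-selected σ-sel i)

Selects-++ : ∀ {j k l} {ρ : Fin j → Fin l} {σ : Fin k → Fin l} {u v w} →
             Selects ρ u v → Selects σ u w → Selects ([ ρ , σ ]′ ∘ splitAt j) u (v ++ w)
Selects-++ {j} {ρ = ρ} {σ} {u} {v} {w} ρ-sel σ-sel =
  selecting λ i → trans (by-cases (splitAt j i)) (sym (Vec.lookup-splitAt j v w i))
  where
  by-cases : ∀ s → lookup u ([ ρ , σ ]′ s) ≡ [ lookup v , lookup w ]′ s
  by-cases (inj₁ a) = lookup-selected ρ-sel a
  by-cases (inj₂ b) = lookup-selected σ-sel b

renameTerm : ∀ {k k'} → (Fin k → Fin k') → Term k → Term k'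
renameTerm ρ (var i) = var (ρ i)
renameTerm ρ (s ⊕ t) = renameTerm ρ s ⊕ renameTerm ρ t

renameForm : ∀ {k k'} → (Fin k → Fin k') → Form k → Form k'
renameForm ρ (s ≐ t)  = renameTerm ρ s ≐ renameTerm ρ t
renameForm ρ (s ≺ t)  = renameTerm ρ s ≺ renameTerm ρ t
renameForm ρ (¬' φ)   = ¬' renameForm ρ φ
renameForm ρ (φ ∧' ψ) = renameForm ρ φ ∧' renameForm ρ ψ
renameForm ρ (φ ∨' ψ) = renameForm ρ φ ∨' renameForm ρ ψ
renameForm ρ (φ ⇒' ψ) = renameForm ρ φ ⇒' renameForm ρ ψ
renameForm ρ (∃' φ)   = ∃' renameForm (lift ρ) φ
renameForm ρ (∀' φ)   = ∀' renameForm (lift ρ) φ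

evalT-rename : ∀ {k k'} {ρ : Fin k → Fin k'} {w v} → Selects ρ w v →
               ∀ t → evalT (renameTerm ρ t) w ≡ evalT t v
evalT-rename sel (var i) = lookup-selected sel i
evalT-rename sel (s ⊕ t) = cong₂ ℤ._+_ (evalT-rename sel s) (evalT-rename sel t)

subst₂-⇔ : ∀ {A : Set} (R : A → A → Set) {a b c d : A} → a ≡ c → b ≡ d → R a b ⇔ R c d
subst₂-⇔ R refl refl = ⇔-id _

⟦⟧-rename : ∀ {k k'} {ρ : Fin k → Fin k'} {w v} → Selects ρ w v →
            ∀ φ → ⟦ renameForm ρ φ ⟧ w ⇔ ⟦ φ ⟧ v
⟦⟧-rename sel (s ≐ t)  = subst₂-⇔ _≡_ (evalT-rename sel s) (evalT-rename sel t)
⟦⟧-rename sel (s ≺ t)  = subst₂-⇔ ℤ._<_ (evalT-rename sel s) (evalT-rename sel t)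
⟦⟧-rename sel (¬' φ)   = ¬-cong-⇔ (⟦⟧-rename sel φ)
⟦⟧-rename sel (φ ∧' ψ) = ⟦⟧-rename sel φ ×-⇔ ⟦⟧-rename sel ψ
⟦⟧-rename sel (φ ∨' ψ) = ⟦⟧-rename sel φ ⊎-⇔ ⟦⟧-rename sel ψ
⟦⟧-rename sel (φ ⇒' ψ) = →-cong-⇔ (⟦⟧-rename sel φ) (⟦⟧-rename sel ψ)
⟦⟧-rename sel (∃' φ)   = Σ.congˡ λ {a} → ⟦⟧-rename (Selects-∷ a sel) φ
⟦⟧-rename sel (∀' φ)   = mk⇔ (λ h a → to (⟦⟧-rename (Selects-∷ a sel) φ) (h a))
                             (λ h a → from (⟦⟧-rename (Selects-∷ a sel) φ) (h a))

Presburger-reindex : ∀ {k k'} {ρ : Fin k → Fin k'} {S : Vec ℤ k → Set} (F : Vec ℤ k' → Vec ℤ k) →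
                     (∀ w → Selects ρ w (F w)) → Presburger S → Presburger (S ∘ F)
Presburger-reindex {ρ = ρ} F sel (φ , S⇔φ) =
  renameForm ρ φ , λ w → ⇔-sym (⟦⟧-rename (sel w) φ) ⇔-∘ S⇔φ (F w)

PresburgerFn-reindex : ∀ {k k'} {ρ : Fin k → Fin k'} {f : Vec ℤ k → ℤ} (F : Vec ℤ k' → Vec ℤ k) →
                       (∀ w → Selects ρ w (F w)) → PresburgerFn f → PresburgerFn (f ∘ F)
PresburgerFn-reindex {ρ = ρ} F sel = Presburger-reindex (λ w → head w ∷ F (tail w)) sel'
  where
  sel' : ∀ w → Selects (lift ρ) w (head w ∷ F (tail w))
  sel' (t ∷ w) = Selects-∷ t (sel w)

Presburger-∩ : ∀ {k} {S T : Vec ℤ k → Set} → Presburger S → Presburger T →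
               Presburger (λ v → S v × T v)
Presburger-∩ (φ , S⇔φ) (ψ , T⇔ψ) = φ ∧' ψ , λ v → S⇔φ v ×-⇔ T⇔ψ v

Presburger-∅ : ∀ {k} → Presburger {k} (λ _ → ⊥)
Presburger-∅ = ∃' (var zero ≺ var zero) , λ v → mk⇔ ⊥-elim (λ (a , a<a) → ℤ.<-irrefl refl a<a)

module _ {k : ℕ} where

  private
    f-graph-vars g-graph-vars : Fin (ℕ.suc k) → Fin (3 + k)
    f-graph-vars zero    = suc zero
    f-graph-vars (suc i) = suc (suc (suc i))
    g-graph-vars zero    = zero
    g-graph-vars (suc i) = suc (suc (suc i))

    H-graph-vars : Fin 3 → Fin (3 + k)
    H-graph-vars zero             = suc (suc zero)
    H-graph-vars (suc zero)       = suc zero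
    H-graph-vars (suc (suc zero)) = zero

    f-graph-selects : ∀ b a t x → Selects f-graph-vars (b ∷ a ∷ t ∷ x) (a ∷ x)
    f-graph-selects b a t x = selecting λ { zero → refl ; (suc i) → refl }

    g-graph-selects : ∀ b a t x → Selects g-graph-vars (b ∷ a ∷ t ∷ x) (b ∷ x)
    g-graph-selects b a t x = selecting λ { zero → refl ; (suc i) → refl }

    H-graph-selects : ∀ b a t x → Selects H-graph-vars (b ∷ a ∷ t ∷ x) (t ∷ a ∷ b ∷ [])
    H-graph-selects b a t x = selecting λ { zero → refl ; (suc zero) → refl ; (suc (suc zero)) → refl }

  -- Inside the two quantifiers the environment is  b ∷ a ∷ t ∷ x  with  a = f x, b = g x.
  PresburgerFn-compose₂ : ∀ {H : Vec ℤ 2 → ℤ} {f g : Vec ℤ k → ℤ} → PresburgerFn H →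
                          PresburgerFn f → PresburgerFn g → PresburgerFn (λ x → H (f x ∷ g x ∷ []))
  PresburgerFn-compose₂ {H} {f} {g} (χ , H⇔χ) (φ , f⇔φ) (ψ , g⇔ψ) =
    ∃' ∃' ((φ′ ∧' ψ′) ∧' χ′) , λ { (t ∷ x) → ⇔-sym (unfold t x ⇔-∘ Σ.congˡ (Σ.congˡ (graphs t x))) }
    where
    φ′ ψ′ χ′ : Form (3 + k)
    φ′ = renameForm f-graph-vars φ
    ψ′ = renameForm g-graph-vars ψ
    χ′ = renameForm H-graph-vars χ

    graphs : ∀ t x {a b} → ((⟦ φ′ ⟧ (b ∷ a ∷ t ∷ x) × ⟦ ψ′ ⟧ (b ∷ a ∷ t ∷ x)) × ⟦ χ′ ⟧ (b ∷ a ∷ t ∷ x))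
                           ⇔ ((f x ≡ a × g x ≡ b) × H (a ∷ b ∷ []) ≡ t)
    graphs t x {a} {b} =
      (⇔-sym (f⇔φ (a ∷ x)) ⇔-∘ ⟦⟧-rename (f-graph-selects b a t x) φ
        ×-⇔ ⇔-sym (g⇔ψ (b ∷ x)) ⇔-∘ ⟦⟧-rename (g-graph-selects b a t x) ψ)
      ×-⇔ ⇔-sym (H⇔χ (t ∷ a ∷ b ∷ [])) ⇔-∘ ⟦⟧-rename (H-graph-selects b a t x) χ

    unfold : ∀ t x → (Σ ℤ λ a → Σ ℤ λ b → (f x ≡ a × g x ≡ b) × H (a ∷ b ∷ []) ≡ t)
                     ⇔ (H (f x ∷ g x ∷ []) ≡ t)
    unfold t x = mk⇔ (λ { (_ , _ , (refl , refl) , eq) → eq }) (λ eq → _ , _ , (refl , refl) , eq)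

graph-by-cases : ∀ {P : Set} → Dec P → ∀ {c x y t : ℤ} → (P → c ≡ x) → (¬ P → c ≡ y) →
                 (c ≡ t) ⇔ ((P × t ≡ x) ⊎ (¬ P × t ≡ y))
graph-by-cases (yes p) c≡x _ = mk⇔ (λ c≡t → inj₁ (p , trans (sym c≡t) (c≡x p)))
  λ { (inj₁ (_ , t≡x)) → trans (c≡x p) (sym t≡x) ; (inj₂ (¬p , _)) → ⊥-elim (¬p p) }
graph-by-cases (no ¬p) _ c≡y = mk⇔ (λ c≡t → inj₂ (¬p , trans (sym c≡t) (c≡y ¬p)))
  λ { (inj₁ (p , _)) → ⊥-elim (¬p p) ; (inj₂ (_ , t≡y)) → trans (c≡y ¬p) (sym t≡y) }

max₂ min₂ : Vec ℤ 2 → ℤ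
max₂ (a ∷ b ∷ []) = a ℤ.⊔ b
min₂ (a ∷ b ∷ []) = a ℤ.⊓ b

private
  var-t var-a var-b : Term 3
  var-t = var zero
  var-a = var (suc zero)
  var-b = var (suc (suc zero))

PresburgerFn-max₂ : PresburgerFn max₂
PresburgerFn-max₂ = ((var-a ≺ var-b) ∧' (var-t ≐ var-b)) ∨' ((¬' (var-a ≺ var-b)) ∧' (var-t ≐ var-a)) ,
  λ { (t ∷ a ∷ b ∷ []) → graph-by-cases (a ℤ.<? b) (ℤ.i≤j⇒i⊔j≡j ∘ ℤ.<⇒≤) (ℤ.i≥j⇒i⊔j≡i ∘ ℤ.≮⇒≥) }

PresburgerFn-min₂ : PresburgerFn min₂
PresburgerFn-min₂ = ((var-a ≺ var-b) ∧' (var-t ≐ var-a)) ∨' ((¬' (var-a ≺ var-b)) ∧' (var-t ≐ var-b)) ,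
  λ { (t ∷ a ∷ b ∷ []) → graph-by-cases (a ℤ.<? b) (ℤ.i≤j⇒i⊓j≡i ∘ ℤ.<⇒≤) (ℤ.i≥j⇒i⊓j≡j ∘ ℤ.≮⇒≥) }

PresburgerFn-⊔ : ∀ {k} {f g : Vec ℤ k → ℤ} → PresburgerFn f → PresburgerFn g →
                 PresburgerFn (λ x → f x ℤ.⊔ g x)
PresburgerFn-⊔ {f = f} {g} = PresburgerFn-compose₂ {H = max₂} {f} {g} PresburgerFn-max₂

PresburgerFn-⊓ : ∀ {k} {f g : Vec ℤ k → ℤ} → PresburgerFn f → PresburgerFn g →
                 PresburgerFn (λ x → f x ℤ.⊓ g x)
PresburgerFn-⊓ {f = f} {g} = PresburgerFn-compose₂ {H = min₂} {f} {g} PresburgerFn-min₂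

≡-mod-sym : ∀ N t k → t ≡ k [mod N ] → k ≡ t [mod N ]
≡-mod-sym N t k = subst (_ ℕ.∣_) (ℤ.∣i-j∣≡∣j-i∣ t k)

≡-mod-trans : ∀ N t s k → t ≡ s [mod N ] → s ≡ k [mod N ] → t ≡ k [mod N ]
≡-mod-trans N t s k t≡s s≡k = Signed.∣⇒∣ᵤ
  (subst (N Signed.∣_) (ℤ.+-minus-telescope t s k)
         (Signed.∣m∣n⇒∣m+n {N} {t ℤ.- s} {s ℤ.- k} (Signed.∣ᵤ⇒∣ t≡s) (Signed.∣ᵤ⇒∣ s≡k)))

≡-mod-0 : ∀ N t k → ℤ.∣ N ∣ ≡ 0 → t ≡ k [mod N ] → t ≡ k
≡-mod-0 N t k ∣N∣≡0 t≡k =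
  ℤ.i-j≡0⇒i≡j t k (ℤ.∣i∣≡0⇒i≡0 (ℕ.0∣⇒≡0 (subst (ℕ._∣ ℤ.∣ t ℤ.- k ∣) ∣N∣≡0 t≡k)))

≡-mod-%ℕ : ∀ N t L .{{_ : ℕ.NonZero L}} → N ∣ ℤ.+ L → (ℤ.+ (t %ℕ L)) ≡ t [mod N ]
≡-mod-%ℕ N t L N∣L = ≡-mod-sym N t _ (Signed.∣⇒∣ᵤ
  (subst (N Signed.∣_) (sym t-r≡q*L) (Signed.∣n⇒∣m*n (t /ℕ L) (Signed.∣ᵤ⇒∣ N∣L))))
  where
  cancel : ∀ r q → (r ℤ.+ q) ℤ.- r ≡ q
  cancel = solve-∀
  t-r≡q*L : t ℤ.- ℤ.+ (t %ℕ L) ≡ (t /ℕ L) ℤ.* ℤ.+ L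
  t-r≡q*L = trans (cong (ℤ._- ℤ.+ (t %ℕ L)) (a≡a%ℕn+[a/ℕn]*n t L)) (cancel (ℤ.+ (t %ℕ L)) _)

_≡_[mod_]? : ∀ t k N → Dec (t ≡ k [mod N ])
t ≡ k [mod N ]? = ℤ.∣ N ∣ ℕ.∣? ℤ.∣ t ℤ.- k ∣

∃-dec-by-%ℕ : ∀ {P : ℤ → Set} L .{{_ : ℕ.NonZero L}} → (∀ t → Dec (P t)) →
              (∀ t → P t → P (ℤ.+ (t %ℕ L))) → Dec (Σ ℤ P)
∃-dec-by-%ℕ {P} L P? reduce with Fin.any? {n = L} (P? ∘ ℤ.+_ ∘ toℕ)
... | yes (i , p) = yes (_ , p)
... | no ¬p       = no λ (t , p) →
  ¬p (fromℕ< (n%ℕd<d t L) , subst (P ∘ ℤ.+_) (sym (Fin.toℕ-fromℕ< (n%ℕd<d t L))) (reduce t p))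

∃-dec-by-uniqueness : ∀ {P : ℤ → Set} c → Dec (P c) → (∀ t → P t → t ≡ c) → Dec (Σ ℤ P)
∃-dec-by-uniqueness c (yes p) _      = yes (c , p)
∃-dec-by-uniqueness c (no ¬p) unique = no λ (t , p) → ¬p (subst _ (unique t p) p)

module _ (k₁ N₁ k₂ N₂ : ℤ) where

  Common : ℤ → Set
  Common t = t ≡ k₁ [mod N₁ ] × t ≡ k₂ [mod N₂ ]

  common-at? : ∀ t → Dec (Common t)
  common-at? t = (t ≡ k₁ [mod N₁ ]?) ×-dec (t ≡ k₂ [mod N₂ ]?)

  common? : Dec (Σ ℤ Common)
  common? with ℤ.∣ N₁ ∣ ℕ.≟ 0 | ℤ.∣ N₂ ∣ ℕ.≟ 0
  ... | yes N₁≡0 | _        = ∃-dec-by-uniqueness k₁ (common-at? k₁) λ t → ≡-mod-0 N₁ t k₁ N₁≡0 ∘ proj₁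
  ... | no _     | yes N₂≡0 = ∃-dec-by-uniqueness k₂ (common-at? k₂) λ t → ≡-mod-0 N₂ t k₂ N₂≡0 ∘ proj₂
  ... | no N₁≢0  | no N₂≢0  = ∃-dec-by-%ℕ L (common-at?) reduce
    where
    L : ℕ
    L = ℤ.∣ N₁ ∣ ℕ.* ℤ.∣ N₂ ∣
    instance
      L≢0 : ℕ.NonZero L
      L≢0 = ℕ.m*n≢0 _ _ {{ℕ.≢-nonZero N₁≢0}} {{ℕ.≢-nonZero N₂≢0}}
    reduce : ∀ t → Common t → Common (ℤ.+ (t %ℕ L))
    reduce t (p₁ , p₂) = ≡-mod-trans N₁ (ℤ.+ (t %ℕ L)) t k₁ (≡-mod-%ℕ N₁ t L (ℕ.m∣m*n ℤ.∣ N₂ ∣)) p₁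
                       , ≡-mod-trans N₂ (ℤ.+ (t %ℕ L)) t k₂ (≡-mod-%ℕ N₂ t L (ℕ.n∣m*n ℤ.∣ N₁ ∣)) p₂

  Common⇔≡-mod-lcm : ∀ {t₀} → Common t₀ →
                     ∀ t → Common t ⇔ t ≡ t₀ [mod ℤ.+ lcm ℤ.∣ N₁ ∣ ℤ.∣ N₂ ∣ ]
  Common⇔≡-mod-lcm {t₀} (q₁ , q₂) t = mk⇔
    (λ (p₁ , p₂) → lcm-least (≡-mod-trans N₁ t k₁ t₀ p₁ (≡-mod-sym N₁ t₀ k₁ q₁))
                             (≡-mod-trans N₂ t k₂ t₀ p₂ (≡-mod-sym N₂ t₀ k₂ q₂)))
    (λ d → ≡-mod-trans N₁ t t₀ k₁ (ℕ.∣-trans (m∣lcm[m,n] ℤ.∣ N₁ ∣ ℤ.∣ N₂ ∣) d) q₁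
         , ≡-mod-trans N₂ t t₀ k₂ (ℕ.∣-trans (n∣lcm[m,n] ℤ.∣ N₁ ∣ ℤ.∣ N₂ ∣) d) q₂)

  common-congruence : (∀ t → ¬ Common t) ⊎ (Σ ℤ λ k → Σ ℤ λ M → ∀ t → Common t ⇔ t ≡ k [mod M ])
  common-congruence with common?
  ... | no ¬c         = inj₁ λ t c → ¬c (t , c)
  ... | yes (t₀ , c₀) = inj₂ (t₀ , ℤ.+ lcm ℤ.∣ N₁ ∣ ℤ.∣ N₂ ∣ , Common⇔≡-mod-lcm c₀)

Bound : ℕ → Set
Bound d = Maybe (Σ (Vec ℤ d → ℤ) PresburgerFn)

Above : ∀ {d} → Bound d → Vec ℤ d → ℤ → Set
Above nothing       x t = ⊤
Above (just (f , _)) x t = f x ℤ.≤ t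

Below : ∀ {d} → Bound d → Vec ℤ d → ℤ → Set
Below nothing       x t = ⊤
Below (just (g , _)) x t = t ℤ.≤ g x

-- A weak cell with each of its two bounds optional, so that the four shapes become one.
record CellForm (d : ℕ) (C : Vec ℤ d × ℤ → Set) : Set₁ where
  constructor cellForm
  field
    base            : Vec ℤ d → Set
    base-presburger : Presburger base
    lower upper     : Bound d
    residue modulus : ℤ
    defining        : ∀ x t → C (x , t) ⇔
                        (base x × Above lower x t × Below upper x t × t ≡ residue [mod modulus ])

private
  pad-bounds : ∀ {S M : Set} → (S × M) ⇔ (S × ⊤ × ⊤ × M)
  pad-bounds = mk⇔ (λ (s , m) → s , _ , _ , m) (λ (s , _ , _ , m) → s , m)

  pad-upper : ∀ {S L M : Set} → (S × L × M) ⇔ (S × L × ⊤ × M)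
  pad-upper = mk⇔ (λ (s , l , m) → s , l , _ , m) (λ (s , l , _ , m) → s , l , m)

  pad-lower : ∀ {S H M : Set} → (S × H × M) ⇔ (S × ⊤ × H × M)
  pad-lower = mk⇔ (λ (s , h , m) → s , _ , h , m) (λ (s , _ , h , m) → s , h , m)

weakCell⇒cellForm : ∀ {d C} → WeakCell d C → CellForm d C
weakCell⇒cellForm (S , pS , k , N , inj₁ e) =
  cellForm S pS nothing nothing k N λ x t → pad-bounds ⇔-∘ e x t
weakCell⇒cellForm (S , pS , k , N , inj₂ (inj₁ (f , pf , e))) =
  cellForm S pS (just (f , pf)) nothing k N λ x t → pad-upper ⇔-∘ e x t
weakCell⇒cellForm (S , pS , k , N , inj₂ (inj₂ (inj₁ (g , pg , e)))) =
  cellForm S pS nothing (just (g , pg)) k N λ x t → pad-lower ⇔-∘ e x t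
weakCell⇒cellForm (S , pS , k , N , inj₂ (inj₂ (inj₂ (f , g , pf , pg , e)))) =
  cellForm S pS (just (f , pf)) (just (g , pg)) k N e

cellForm⇒weakCell : ∀ {d C} → CellForm d C → WeakCell d C
cellForm⇒weakCell (cellForm S pS nothing nothing k N e) =
  S , pS , k , N , inj₁ λ x t → ⇔-sym pad-bounds ⇔-∘ e x t
cellForm⇒weakCell (cellForm S pS (just (f , pf)) nothing k N e) =
  S , pS , k , N , inj₂ (inj₁ (f , pf , λ x t → ⇔-sym pad-upper ⇔-∘ e x t))
cellForm⇒weakCell (cellForm S pS nothing (just (g , pg)) k N e) =
  S , pS , k , N , inj₂ (inj₂ (inj₁ (g , pg , λ x t → ⇔-sym pad-lower ⇔-∘ e x t)))
cellForm⇒weakCell (cellForm S pS (just (f , pf)) (just (g , pg)) k N e) =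
  S , pS , k , N , inj₂ (inj₂ (inj₂ (f , g , pf , pg , e)))

module _ {k k' : ℕ} {ρ : Fin k → Fin k'} (F : Vec ℤ k' → Vec ℤ k) (sel : ∀ w → Selects ρ w (F w)) where

  Bound-reindex : Bound k → Bound k'
  Bound-reindex = Maybe.map λ (f , pf) → f ∘ F , PresburgerFn-reindex {f = f} F sel pf

  Above-reindex : ∀ b w t → Above b (F w) t ⇔ Above (Bound-reindex b) w t
  Above-reindex nothing  w t = ⇔-id _
  Above-reindex (just _) w t = ⇔-id _

  Below-reindex : ∀ b w t → Below b (F w) t ⇔ Below (Bound-reindex b) w t
  Below-reindex nothing  w t = ⇔-id _
  Below-reindex (just _) w t = ⇔-id _

  CellForm-reindex : ∀ {C} → CellForm k C → CellForm k' (λ (w , t) → C (F w , t))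
  CellForm-reindex (cellForm S pS lo hi r N e) =
    cellForm (S ∘ F) (Presburger-reindex F sel pS) (Bound-reindex lo) (Bound-reindex hi) r N
      λ w t → (⇔-id _ ×-⇔ Above-reindex lo w t ×-⇔ Below-reindex hi w t ×-⇔ ⇔-id _) ⇔-∘ e (F w) t

_⊔ᴮ_ : ∀ {d} → Bound d → Bound d → Bound d
nothing        ⊔ᴮ b              = b
just a         ⊔ᴮ nothing        = just a
just (f , pf)  ⊔ᴮ just (g , pg)  = just ((λ x → f x ℤ.⊔ g x) , PresburgerFn-⊔ {f = f} {g} pf pg)

_⊓ᴮ_ : ∀ {d} → Bound d → Bound d → Bound d
nothing        ⊓ᴮ b              = b
just a         ⊓ᴮ nothing        = just a
just (f , pf)  ⊓ᴮ just (g , pg)  = just ((λ x → f x ℤ.⊓ g x) , PresburgerFn-⊓ {f = f} {g} pf pg)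

Above-⊔ᴮ : ∀ {d} (a b : Bound d) x t → (Above a x t × Above b x t) ⇔ Above (a ⊔ᴮ b) x t
Above-⊔ᴮ nothing        b               x t = mk⇔ proj₂ (_ ,_)
Above-⊔ᴮ (just _)       nothing         x t = mk⇔ proj₁ (_, _)
Above-⊔ᴮ (just (f , _)) (just (g , _))  x t =
  mk⇔ (uncurry ℤ.⊔-lub) λ h → ℤ.i⊔j≤k⇒i≤k (f x) (g x) h , ℤ.i⊔j≤k⇒j≤k (f x) (g x) h

Below-⊓ᴮ : ∀ {d} (a b : Bound d) x t → (Below a x t × Below b x t) ⇔ Below (a ⊓ᴮ b) x t
Below-⊓ᴮ nothing        b               x t = mk⇔ proj₂ (_ ,_)
Below-⊓ᴮ (just _)       nothing         x t = mk⇔ proj₁ (_, _)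
Below-⊓ᴮ (just (f , _)) (just (g , _))  x t =
  mk⇔ (uncurry ℤ.⊓-glb) λ h → ℤ.i≤j⊓k⇒i≤j (f x) (g x) h , ℤ.i≤j⊓k⇒i≤k (f x) (g x) h

×-transpose₄ : ∀ {A B C D A' B' C' D' : Set} →
               ((A × B × C × D) × (A' × B' × C' × D')) ⇔ ((A × A') × (B × B') × (C × C') × (D × D'))
×-transpose₄ = mk⇔ (λ ((a , b , c , d) , (a' , b' , c' , d')) → (a , a') , (b , b') , (c , c') , (d , d'))
                   (λ ((a , a') , (b , b') , (c , c') , (d , d')) → (a , b , c , d) , (a' , b' , c' , d'))

CellForm-∩ : ∀ {d C D} → CellForm d C → CellForm d D → CellForm d (λ p → C p × D p)
CellForm-∩ (cellForm S₁ pS₁ lo₁ hi₁ k₁ N₁ e₁) (cellForm S₂ pS₂ lo₂ hi₂ k₂ N₂ e₂)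
  with common-congruence k₁ N₁ k₂ N₂
... | inj₁ disjoint = cellForm (λ _ → ⊥) Presburger-∅ nothing nothing k₁ N₁ λ x t → mk⇔
  (λ (c , d) → ⊥-elim (disjoint t (congruence (to (e₁ x t) c) , congruence (to (e₂ x t) d))))
  (λ { (() , _) })
  where
  congruence : ∀ {S L H M : Set} → S × L × H × M → M
  congruence (_ , _ , _ , m) = m
... | inj₂ (k , N , common⇔) =
  cellForm (λ x → S₁ x × S₂ x) (Presburger-∩ pS₁ pS₂) (lo₁ ⊔ᴮ lo₂) (hi₁ ⊓ᴮ hi₂) k N λ x t →
    (⇔-id _ ×-⇔ Above-⊔ᴮ lo₁ lo₂ x t ×-⇔ Below-⊓ᴮ hi₁ hi₂ x t ×-⇔ common⇔ t)
      ⇔-∘ (×-transpose₄ ⇔-∘ (e₁ x t ×-⇔ e₂ x t))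

diamondˡ diamondʳ : ∀ m n → Vec ℤ (m + (m + n)) → Vec ℤ (m + n)
diamondˡ m n v = take m v ++ drop m (drop m v)
diamondʳ m n v = take m (drop m v) ++ drop m (drop m v)

diamondˡ-coords diamondʳ-coords : ∀ m n → Fin (m + n) → Fin (m + (m + n))
diamondˡ-coords m n = [ _↑ˡ (m + n) , (m ↑ʳ_) ∘ (m ↑ʳ_) ]′ ∘ splitAt m
diamondʳ-coords m n = [ (m ↑ʳ_) ∘ (_↑ˡ n) , (m ↑ʳ_) ∘ (m ↑ʳ_) ]′ ∘ splitAt m

diamondˡ-selects : ∀ m n v → Selects (diamondˡ-coords m n) v (diamondˡ m n v)
diamondˡ-selects m n v =
  Selects-++ (take-selects m v) (Selects-∘ (drop-selects m v) (drop-selects m (drop m v)))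

diamondʳ-selects : ∀ m n v → Selects (diamondʳ-coords m n) v (diamondʳ m n v)
diamondʳ-selects m n v =
  Selects-++ (Selects-∘ (drop-selects m v) (take-selects m (drop m v)))
             (Selects-∘ (drop-selects m v) (drop-selects m (drop m v)))

mainTheorem5 : (m n : ℕ) (A B : Vec ℤ (m + n) × ℤ → Set)
    → WeakCell (m + n) A → WeakCell (m + n) B
    → WeakCell (m + (m + n)) (Diamond m n A B)
mainTheorem5 m n A B cellA cellB = cellForm⇒weakCell (CellForm-∩ Aˡ Bʳ)
  where
  Aˡ : CellForm (m + (m + n)) (λ (v , t) → A (diamondˡ m n v , t))
  Aˡ = CellForm-reindex (diamondˡ m n) (diamondˡ-selects m n) (weakCell⇒cellForm cellA)
  Bʳ : CellForm (m + (m + n)) (λ (v , t) → B (diamondʳ m n v , t))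
  Bʳ = CellForm-reindex (diamondʳ m n) (diamondʳ-selects m n) (weakCell⇒cellForm cellB)
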